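{- Let $\alpha,z$ be independent Haar-random elements of $\mathbf{Z}_2$ and $y$ an independent Haar-random element of $\mathbf{Z}_2^\times$, and let $k\ge0$ be an integer. Then: (1) $\Pr\big(v_2(\alpha^2+4yz)=k,\ \mathsf{sqf}(\alpha^2+4yz)\equiv1\pmod8\big)=\Pr\big(v_2(\alpha^2+4yz)=k,\ \mathsf{sqf}(\alpha^2+4yz)\equiv5\pmod8\big)$, and this common value is $0$ if $k$ is odd and $2^{ -(k+2)}$ if $k$ is even; (2) $\Pr\big(v_2(\alpha^2+4yz)=k,\ \mathsf{sqf}(\alpha^2+4yz)\equiv3\pmod4\big)$ is $0$ if $k$ is odd or $k=0$, and $2^{ -(k+1)}$ if $k\ge2$ is even; (3) $\Pr\big(v_2(\alpha^2+4yz)=k,\ \mathsf{sqf}(\alpha^2+4yz)\equiv2\pmod4\big)$ is $0$ if $k$ is even or $k=1$, and $2^{ -k}$ if $k\ge3$ is odd.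
   Context: For nonzero $\beta\in\mathbf{Z}_2$ write $\beta=2^{v}u$ with $v=v_2(\beta)$, $u\in\mathbf{Z}_2^\times$. The condition $\mathsf{sqf}(\beta)\equiv i\pmod 8$ for odd $i$ means $v$ even and $u\equiv i\pmod8$; $\mathsf{sqf}(\beta)\equiv3\pmod4$ means $v$ even and $u\equiv3\pmod4$; $\mathsf{sqf}(\beta)\equiv2\pmod4$ means $v$ odd. (Here $\mathsf{sqf}(\beta)=2^{v\bmod 2}u$ is the squarefree part, defined up to unit squares; $\alpha^2+4yz\neq0$ almost surely.) -}

module Defs where

open import Data.Nat using (ℕ; zero; suc; _+_; _*_; _∸_; _^_; _%_; _/_; _≡ᵇ_; NonZero)
open import Data.Nat.Properties using (m^n≢0)
open import Data.Bool using (Bool; true; false; _∧_; not; if_then_else_)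
open import Data.List using (List; map; upTo)
open import Data.Nat.ListAction using (sum)
open import Data.Integer using (+_)
import Data.Rational as ℚ
open ℚ using (ℚ)

_%2^_ : ℕ → ℕ → ℕ
b %2^ n = _%_ b (2 ^ n) {{m^n≢0 2 n}}

_/2^_ : ℕ → ℕ → ℕ
b /2^ n = _/_ b (2 ^ n) {{m^n≢0 2 n}}

Σ< : ℕ → (ℕ → ℕ) → ℕ
Σ< n f = sum (map f (upTo n))

𝟙 : Bool → ℕ
𝟙 true  = 1
𝟙 false = 0

-- An event about β = α²+4yz ∈ Z₂ is modelled by a Boolean predicate on the
-- residue b = β mod 2^N (0 ≤ b < 2^N).
Event : Set
Event = ℕ → Bool

-- Haar probability at truncation level N: α, z uniform in Z/2^N, y uniform
-- in (Z/2^N)^×, i.e. the count of triples (a,y,z) ∈ [0,2^N)^3 with y odd and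
-- E((a²+4yz) mod 2^N), divided by 2^N · 2^(N-1) · 2^N = 2^(3N ∸ 1).
-- For an event determined by β mod 2^N this is exactly the Haar probability.
count : ℕ → Event → ℕ
count N E =
  Σ< (2 ^ N) λ a → Σ< (2 ^ N) λ y → Σ< (2 ^ N) λ z →
    𝟙 ((y % 2 ≡ᵇ 1) ∧ E ((a * a + 4 * y * z) %2^ N))

Pr : ℕ → Event → ℚ
Pr N E = ℚ._/_ (+ count N E) (2 ^ (3 * N ∸ 1)) {{m^n≢0 2 (3 * N ∸ 1)}}

-- v₂(β) = k, read off from b = β mod 2^N (valid for k < N):
-- 2^k ∣ b and 2^(k+1) ∤ b.
val≡ : ℕ → Event
val≡ k b = (b %2^ k ≡ᵇ 0) ∧ not (b %2^ suc k ≡ᵇ 0)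

-- The unit part u = β / 2^k modulo m (valid when v₂(β) = k and k + 3 ≤ N, m ∣ 8).
unitMod : ℕ → (m : ℕ) → .{{NonZero m}} → ℕ → ℕ
unitMod k m b = (b /2^ k) % m

evenᵇ : ℕ → Bool
evenᵇ v = v % 2 ≡ᵇ 0

-- Events "v₂(β) = k and sqf(β) ≡ ... " following the context:
-- sqf(β) ≡ i (mod 8), i odd  ⇔  v₂ even and u ≡ i (mod 8);
-- sqf(β) ≡ 3 (mod 4)        ⇔  v₂ even and u ≡ 3 (mod 4);
-- sqf(β) ≡ 2 (mod 4)        ⇔  v₂ odd.
ev-sqf≡mod8 : (k i : ℕ) → Event
ev-sqf≡mod8 k i b = val≡ k b ∧ evenᵇ k ∧ (unitMod k 8 b ≡ᵇ i)

ev-sqf≡3mod4 : ℕ → Event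
ev-sqf≡3mod4 k b = val≡ k b ∧ evenᵇ k ∧ (unitMod k 4 b ≡ᵇ 3)

ev-sqf≡2mod4 : ℕ → Event
ev-sqf≡2mod4 k b = val≡ k b ∧ not (evenᵇ k)

2^-_ : ℕ → ℚ
2^- e = ℚ._/_ (+ 1) (2 ^ e) {{m^n≢0 2 e}}

-- Write β = α² + 4yz.  Modulo 2^(n+2) one has β ≡ r + 4(α²/4 + yz) with r = α² mod 4 ∈ {0, 1},
-- and since y is odd, z ↦ α²/4 + yz permutes the residues mod 2^n.  So β is distributed as r + 4t
-- with t uniform and r = 0, 1 equally likely.  For r = 1, v₂(β) = 0 and the unit part is 1 or 5
-- mod 8 with equal probability.  For r = 0, β = 4t, so v₂(β) ≠ 1, and v₂(β) = k ≥ 2 means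
-- v₂(t) = k − 2, with all four odd unit residues mod 8 equally likely.  In every case each
-- admissible unit residue mod 8 has probability 2^-(k+2), so each part of the theorem comes down
-- to counting the admissible residues allowed by the condition on sqf(β).

module Submission where

open import Defs
open import Data.Nat using (ℕ; _+_; _≤_)
open import Data.Nat.Divisibility using (_∣_)
open import Data.Product using (_×_)
open import Data.Sum using (_⊎_)
open import Relation.Nullary using (¬_)
open import Relation.Binary.PropositionalEquality using (_≡_)
open import Data.Rational using (ℚ; 0ℚ)

open import Data.Bool using (Bool; true; false; _∧_; not; T)
import Data.Integer as ℤ
import Data.Integer.Properties as ℤP
open import Data.List using (upTo; map; _++_; [_])
open import Data.List.Properties using (upTo-∷ʳ; map-++)
open import Data.Nat using (NonZero; zero; suc; _*_; _∸_; _^_; _≡ᵇ_; s≤s)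
open import Data.Nat.DivMod
open import Data.Nat.Divisibility using (divides; divides-refl; ∣-refl; n∣m⇒m%n≡0; m%n≡0⇒n∣m; ∣1⇒≡1)
open import Data.Nat.ListAction using (sum)
open import Data.Nat.ListAction.Properties using (sum-++)
open import Data.Nat.Properties
open import Algebra.Properties.CommutativeSemigroup +-commutativeSemigroup
  using () renaming (interchange to +-interchange)
open import Data.Nat.Tactic.RingSolver using (solve-∀)
open import Data.Product using (_,_)
open import Data.Sum using (inj₁; inj₂)
import Data.Rational as ℚ
import Data.Rational.Properties as ℚP
open import Data.Rational.Unnormalised using (mkℚᵘ; *≡*)
open import Function using (_∘_)
open import Relation.Nullary using (contradiction)
open import Relation.Binary.PropositionalEquality
  using (refl; sym; trans; cong; cong₂; subst; module ≡-Reasoning)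
open ≡-Reasoning

Σ<-suc : ∀ n f → Σ< (suc n) f ≡ Σ< n f + f n
Σ<-suc n f = begin
  sum (map f (upTo (suc n)))       ≡⟨ cong (sum ∘ map f) (upTo-∷ʳ n) ⟨
  sum (map f (upTo n ++ [ n ]))    ≡⟨ cong sum (map-++ f (upTo n) [ n ]) ⟩
  sum (map f (upTo n) ++ [ f n ])  ≡⟨ sum-++ (map f (upTo n)) [ f n ] ⟩
  Σ< n f + (f n + 0)               ≡⟨ cong (Σ< n f +_) (+-identityʳ (f n)) ⟩
  Σ< n f + f n                     ∎

Σ<-cong : ∀ n {f g} → (∀ i → f i ≡ g i) → Σ< n f ≡ Σ< n g
Σ<-cong zero    f≗g = refl
Σ<-cong (suc n) {f} {g} f≗g = begin
  Σ< (suc n) f  ≡⟨ Σ<-suc n f ⟩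
  Σ< n f + f n  ≡⟨ cong₂ _+_ (Σ<-cong n f≗g) (f≗g n) ⟩
  Σ< n g + g n  ≡⟨ Σ<-suc n g ⟨
  Σ< (suc n) g  ∎

Σ<-zero : ∀ n → Σ< n (λ _ → 0) ≡ 0
Σ<-zero zero    = refl
Σ<-zero (suc n) = trans (Σ<-suc n _) (cong (_+ 0) (Σ<-zero n))

Σ<-+ : ∀ m n f → Σ< (m + n) f ≡ Σ< m f + Σ< n (λ i → f (m + i))
Σ<-+ m zero    f = trans (cong (λ l → Σ< l f) (+-identityʳ m)) (sym (+-identityʳ _))
Σ<-+ m (suc n) f = begin
  Σ< (m + suc n) f                               ≡⟨ cong (λ l → Σ< l f) (+-suc m n) ⟩
  Σ< (suc (m + n)) f                             ≡⟨ Σ<-suc (m + n) f ⟩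
  Σ< (m + n) f + f (m + n)                       ≡⟨ cong (_+ f (m + n)) (Σ<-+ m n f) ⟩
  Σ< m f + Σ< n (λ i → f (m + i)) + f (m + n)    ≡⟨ +-assoc (Σ< m f) _ _ ⟩
  Σ< m f + (Σ< n (λ i → f (m + i)) + f (m + n))  ≡⟨ cong (Σ< m f +_) (Σ<-suc n (λ i → f (m + i))) ⟨
  Σ< m f + Σ< (suc n) (λ i → f (m + i))          ∎

Σ<-2* : ∀ n f → Σ< (2 * n) f ≡ Σ< n f + Σ< n (λ i → f (n + i))
Σ<-2* n f = trans (cong (λ l → Σ< (n + l) f) (+-identityʳ n)) (Σ<-+ n n f)

Σ<-distrib-+ : ∀ n f g → Σ< n (λ i → f i + g i) ≡ Σ< n f + Σ< n g
Σ<-distrib-+ zero    f g = refl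
Σ<-distrib-+ (suc n) f g = begin
  Σ< (suc n) (λ i → f i + g i)          ≡⟨ Σ<-suc n _ ⟩
  Σ< n (λ i → f i + g i) + (f n + g n)  ≡⟨ cong (_+ (f n + g n)) (Σ<-distrib-+ n f g) ⟩
  Σ< n f + Σ< n g + (f n + g n)         ≡⟨ +-interchange (Σ< n f) (Σ< n g) (f n) (g n) ⟩
  (Σ< n f + f n) + (Σ< n g + g n)       ≡⟨ cong₂ _+_ (Σ<-suc n f) (Σ<-suc n g) ⟨
  Σ< (suc n) f + Σ< (suc n) g           ∎

Σ<-*ˡ : ∀ n c f → Σ< n (λ i → c * f i) ≡ c * Σ< n f
Σ<-*ˡ zero    c f = sym (*-zeroʳ c)
Σ<-*ˡ (suc n) c f = begin
  Σ< (suc n) (λ i → c * f i)      ≡⟨ Σ<-suc n _ ⟩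
  Σ< n (λ i → c * f i) + c * f n  ≡⟨ cong (_+ c * f n) (Σ<-*ˡ n c f) ⟩
  c * Σ< n f + c * f n            ≡⟨ *-distribˡ-+ c (Σ< n f) (f n) ⟨
  c * (Σ< n f + f n)              ≡⟨ cong (c *_) (Σ<-suc n f) ⟨
  c * Σ< (suc n) f                ∎

Σ<-*ʳ : ∀ n c f → Σ< n (λ i → f i * c) ≡ Σ< n f * c
Σ<-*ʳ n c f = trans (Σ<-cong n (λ i → *-comm (f i) c)) (trans (Σ<-*ˡ n c f) (*-comm c (Σ< n f)))

Σ<-* : ∀ m n f → Σ< (m * n) f ≡ Σ< m (λ q → Σ< n (λ r → f (q * n + r)))
Σ<-* zero    n f = refl
Σ<-* (suc m) n f = begin
  Σ< (n + m * n) f                                    ≡⟨ cong (λ l → Σ< l f) (+-comm n (m * n)) ⟩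
  Σ< (m * n + n) f                                    ≡⟨ Σ<-+ (m * n) n f ⟩
  Σ< (m * n) f + Σ< n (λ r → f (m * n + r))           ≡⟨ cong (_+ Σ< n (λ r → f (m * n + r))) (Σ<-* m n f) ⟩
  Σ< m (λ q → Σ< n (λ r → f (q * n + r))) + Σ< n (λ r → f (m * n + r))
                                                      ≡⟨ Σ<-suc m _ ⟨
  Σ< (suc m) (λ q → Σ< n (λ r → f (q * n + r)))       ∎

Σ<-periodic : ∀ m n f → (∀ i → f (n + i) ≡ f i) → Σ< (m * n) f ≡ m * Σ< n f
Σ<-periodic zero    n f periodic = refl
Σ<-periodic (suc m) n f periodic = begin
  Σ< (n + m * n) f                       ≡⟨ Σ<-+ n (m * n) f ⟩
  Σ< n f + Σ< (m * n) (λ i → f (n + i))  ≡⟨ cong (Σ< n f +_) (Σ<-cong (m * n) periodic) ⟩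
  Σ< n f + Σ< (m * n) f                  ≡⟨ cong (Σ< n f +_) (Σ<-periodic m n f periodic) ⟩
  Σ< n f + m * Σ< n f                    ∎

-- Odd affine maps permute the residues modulo 2^n

m%[n*o]≡m%o+[m/o%n]*o : ∀ m n o .{{_ : NonZero n}} .{{_ : NonZero o}} {{_ : NonZero (n * o)}} →
                        m % (n * o) ≡ m % o + m / o % n * o
m%[n*o]≡m%o+[m/o%n]*o m n o = begin
  m % (n * o)                            ≡⟨ m≡m%n+[m/n]*n (m % (n * o)) o ⟩
  m % (n * o) % o + m % (n * o) / o * o  ≡⟨ cong₂ (λ a b → a + b * o)
                                                  (m∣n⇒o%n%m≡o%m o (n * o) m (divides n refl))
                                                  (m%[n*o]/o≡m/o%n m n o) ⟩
  m % o + m / o % n * o                  ∎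

n%2-cases : ∀ n → n % 2 ≡ 0 × suc n % 2 ≡ 1 ⊎ n % 2 ≡ 1 × suc n % 2 ≡ 0
n%2-cases zero          = inj₁ (refl , refl)
n%2-cases (suc zero)    = inj₂ (refl , refl)
n%2-cases (suc (suc n)) rewrite %-remove-+ˡ n (∣-refl {2}) | %-remove-+ˡ (suc n) (∣-refl {2}) = n%2-cases n

%2^-suc-halves : ∀ n x →
    x %2^ suc n ≡ x %2^ n × (x + 2 ^ n) %2^ suc n ≡ 2 ^ n + x %2^ n
  ⊎ x %2^ suc n ≡ 2 ^ n + x %2^ n × (x + 2 ^ n) %2^ suc n ≡ x %2^ n
%2^-suc-halves n x = halves (n%2-cases q)
  where
  P = 2 ^ n
  r = x %2^ n
  q = x /2^ n
  instance _ = m^n≢0 2 n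

  split : ∀ y → y %2^ suc n ≡ y %2^ n + y /2^ n % 2 * P
  split y = m%[n*o]≡m%o+[m/o%n]*o y 2 P {{_}} {{_}} {{m^n≢0 2 (suc n)}}

  [x+P]/P≡1+q : (x + P) /2^ n ≡ suc q
  [x+P]/P≡1+q = trans (+-distrib-/-∣ʳ x ∣-refl) (trans (cong (q +_) (n/n≡1 P)) (+-comm q 1))

  split-x+P : (x + P) %2^ suc n ≡ r + suc q % 2 * P
  split-x+P = trans (split (x + P)) (cong₂ (λ a b → a + b % 2 * P) ([m+n]%n≡m%n x P) [x+P]/P≡1+q)

  r+0*P : r + 0 * P ≡ r
  r+0*P = +-identityʳ r

  r+1*P : r + 1 * P ≡ P + r
  r+1*P = trans (cong (r +_) (+-identityʳ P)) (+-comm r P)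

  via : ∀ {y a b t} → y ≡ r + a * P → a ≡ b → r + b * P ≡ t → y ≡ t
  via y≡ a≡b ≡t = trans y≡ (trans (cong (λ a → r + a * P) a≡b) ≡t)

  halves : q % 2 ≡ 0 × suc q % 2 ≡ 1 ⊎ q % 2 ≡ 1 × suc q % 2 ≡ 0 →
      x %2^ suc n ≡ r × (x + P) %2^ suc n ≡ P + r
    ⊎ x %2^ suc n ≡ P + r × (x + P) %2^ suc n ≡ r
  halves (inj₁ (q-even , 1+q-odd)) = inj₁ (via (split x) q-even r+0*P , via split-x+P 1+q-odd r+1*P)
  halves (inj₂ (q-odd , 1+q-even)) = inj₂ (via (split x) q-odd r+1*P , via split-x+P 1+q-even r+0*P)

%2^-suc-pair : ∀ n (g : ℕ → ℕ) x →
               g (x %2^ suc n) + g ((x + 2 ^ n) %2^ suc n) ≡ g (x %2^ n) + g (2 ^ n + x %2^ n)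
%2^-suc-pair n g x with %2^-suc-halves n x
... | inj₁ (x≡r , x+P≡P+r) = cong₂ (λ a b → g a + g b) x≡r x+P≡P+r
... | inj₂ (x≡P+r , x+P≡r) = trans (+-comm (g _) (g _)) (cong₂ (λ a b → g a + g b) x+P≡r x≡P+r)

-- Pairing z with 2^n + z: as 1 + 2w is odd, (1 + 2w) · 2^n ≡ 2^n (mod 2^(n+1)), so the two images
-- are the two lifts of one residue mod 2^n, and the sum reduces to level n for g t + g (2^n + t).
Σ<-odd-affine : ∀ n (g : ℕ → ℕ) c w →
                Σ< (2 ^ n) (λ z → g ((c + (1 + w * 2) * z) %2^ n)) ≡ Σ< (2 ^ n) g
Σ<-odd-affine zero    g c w = cong (λ v → g v + 0) (n%1≡0 (c + (1 + w * 2) * 0))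
Σ<-odd-affine (suc n) g c w = begin
  Σ< (2 * P) (λ z → g (⟦ z ⟧ %2^ suc n))
    ≡⟨ Σ<-2* P _ ⟩
  Σ< P (λ z → g (⟦ z ⟧ %2^ suc n)) + Σ< P (λ z → g (⟦ P + z ⟧ %2^ suc n))
    ≡⟨ Σ<-distrib-+ P _ _ ⟨
  Σ< P (λ z → g (⟦ z ⟧ %2^ suc n) + g (⟦ P + z ⟧ %2^ suc n))
    ≡⟨ Σ<-cong P pair ⟩
  Σ< P (λ z → h (⟦ z ⟧ %2^ n))
    ≡⟨ Σ<-odd-affine n h c w ⟩
  Σ< P h
    ≡⟨ Σ<-distrib-+ P g (λ t → g (P + t)) ⟩
  Σ< P g + Σ< P (λ t → g (P + t))
    ≡⟨ Σ<-2* P g ⟨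
  Σ< (2 * P) g ∎
  where
  P = 2 ^ n
  ⟦_⟧ : ℕ → ℕ
  ⟦ z ⟧ = c + (1 + w * 2) * z
  h : ℕ → ℕ
  h t = g t + g (P + t)

  ⟦P+z⟧≡⟦z⟧+P+w*2P : ∀ c w P z → c + (1 + w * 2) * (P + z) ≡ c + (1 + w * 2) * z + P + w * (2 * P)
  ⟦P+z⟧≡⟦z⟧+P+w*2P = solve-∀

  pair : ∀ z → g (⟦ z ⟧ %2^ suc n) + g (⟦ P + z ⟧ %2^ suc n) ≡ h (⟦ z ⟧ %2^ n)
  pair z = begin
    g (⟦ z ⟧ %2^ suc n) + g (⟦ P + z ⟧ %2^ suc n)
      ≡⟨ cong (λ v → g (⟦ z ⟧ %2^ suc n) + g (v %2^ suc n)) (⟦P+z⟧≡⟦z⟧+P+w*2P c w P z) ⟩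
    g (⟦ z ⟧ %2^ suc n) + g ((⟦ z ⟧ + P + w * (2 * P)) %2^ suc n)
      ≡⟨ cong (λ v → g (⟦ z ⟧ %2^ suc n) + g v)
              ([m+kn]%n≡m%n (⟦ z ⟧ + P) w (2 * P) {{m^n≢0 2 (suc n)}}) ⟩
    g (⟦ z ⟧ %2^ suc n) + g ((⟦ z ⟧ + P) %2^ suc n)
      ≡⟨ %2^-suc-pair n g ⟦ z ⟧ ⟩
    h (⟦ z ⟧ %2^ n) ∎

-- Reduction to the residues 4t and 1 + 4t

residueCount : Event → ℕ → ℕ → ℕ
residueCount E n r = Σ< (2 ^ n) (λ t → 𝟙 (E (r + t * 4)))

%2^[2+n]-split : ∀ n x m → (x + m * 4) %2^ (2 + n) ≡ x % 4 + (x / 4 + m) %2^ n * 4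
%2^[2+n]-split n x m = begin
  (x + m * 4) %2^ (2 + n)                    ≡⟨ %-congʳ (trans (sym (*-assoc 2 2 P)) (*-comm 4 P)) ⟩
  (x + m * 4) % (P * 4)                      ≡⟨ m%[n*o]≡m%o+[m/o%n]*o (x + m * 4) P 4 ⟩
  (x + m * 4) % 4 + (x + m * 4) / 4 % P * 4  ≡⟨ cong₂ (λ a b → a + b % P * 4)
                                                      ([m+kn]%n≡m%n x m 4) [x+m*4]/4≡x/4+m ⟩
  x % 4 + (x / 4 + m) % P * 4                ∎
  where
  P = 2 ^ n
  instance
    _ = m^n≢0 2 n
    _ = m^n≢0 2 (2 + n)
    P*4≢0 = m*n≢0 P 4
  [x+m*4]/4≡x/4+m : (x + m * 4) / 4 ≡ x / 4 + m
  [x+m*4]/4≡x/4+m = trans (+-distrib-/-∣ʳ x (divides-refl m)) (cong (x / 4 +_) (m*n/n≡m m 4))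

Σ<-odd-indicator : ∀ n → Σ< (2 ^ suc n) (λ y → 𝟙 (y % 2 ≡ᵇ 1)) ≡ 2 ^ n
Σ<-odd-indicator n = begin
  Σ< (2 * 2 ^ n) odd  ≡⟨ cong (λ l → Σ< l odd) (*-comm 2 (2 ^ n)) ⟩
  Σ< (2 ^ n * 2) odd  ≡⟨ Σ<-periodic (2 ^ n) 2 odd
                            (λ i → cong (λ v → 𝟙 (v ≡ᵇ 1)) (%-remove-+ˡ i (divides-refl 1))) ⟩
  2 ^ n * 1           ≡⟨ *-identityʳ (2 ^ n) ⟩
  2 ^ n               ∎
  where
  odd : ℕ → ℕ
  odd y = 𝟙 (y % 2 ≡ᵇ 1)

fibre-count : ∀ n E a y → y % 2 ≡ 1 →
              Σ< (2 ^ (2 + n)) (λ z → 𝟙 (E ((a * a + 4 * y * z) %2^ (2 + n))))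
                ≡ 4 * residueCount E n (a * a % 4)
fibre-count n E a y y-odd = begin
  Σ< (2 ^ (2 + n)) (λ z → 𝟙 (E ((a * a + 4 * y * z) %2^ (2 + n))))
    ≡⟨ Σ<-cong (2 ^ (2 + n)) (λ z → cong (λ v → 𝟙 (E v)) (reduce z)) ⟩
  Σ< (2 ^ (2 + n)) (λ z → G ((c + y * z) %2^ n))
    ≡⟨ cong (λ l → Σ< l (λ z → G ((c + y * z) %2^ n))) (sym (*-assoc 2 2 P)) ⟩
  Σ< (4 * P) (λ z → G ((c + y * z) %2^ n))
    ≡⟨ Σ<-periodic 4 P _ periodic ⟩
  4 * Σ< P (λ z → G ((c + y * z) %2^ n))
    ≡⟨ cong (λ v → 4 * Σ< P (λ z → G ((c + v * z) %2^ n))) y≡1+[y/2]*2 ⟩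
  4 * Σ< P (λ z → G ((c + (1 + y / 2 * 2) * z) %2^ n))
    ≡⟨ cong (4 *_) (Σ<-odd-affine n G c (y / 2)) ⟩
  4 * Σ< P G ∎
  where
  P = 2 ^ n
  c = a * a / 4
  G : ℕ → ℕ
  G t = 𝟙 (E (a * a % 4 + t * 4))

  4yz≡yz4 : ∀ y z → 4 * y * z ≡ y * z * 4
  4yz≡yz4 = solve-∀

  reduce : ∀ z → (a * a + 4 * y * z) %2^ (2 + n) ≡ a * a % 4 + (c + y * z) %2^ n * 4
  reduce z = trans (cong (λ v → (a * a + v) %2^ (2 + n)) (4yz≡yz4 y z)) (%2^[2+n]-split n (a * a) (y * z))

  c+y[P+i]≡c+yi+yP : ∀ c y P i → c + y * (P + i) ≡ c + y * i + y * P
  c+y[P+i]≡c+yi+yP = solve-∀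

  periodic : ∀ i → G ((c + y * (P + i)) %2^ n) ≡ G ((c + y * i) %2^ n)
  periodic i = cong G (trans (cong (_%2^ n) (c+y[P+i]≡c+yi+yP c y P i))
                             ([m+kn]%n≡m%n (c + y * i) y P {{m^n≢0 2 n}}))

  y≡1+[y/2]*2 : y ≡ 1 + y / 2 * 2
  y≡1+[y/2]*2 = trans (m≡m%n+[m/n]*n y 2) (cong (_+ y / 2 * 2) y-odd)

count-residues : ∀ n E →
  count (2 + n) E ≡ 2 ^ suc n * (4 * (2 ^ suc n * (residueCount E n 0 + residueCount E n 1)))
count-residues n E = begin
  count (2 + n) E
    ≡⟨ Σ<-cong M (λ a → Σ<-cong M (λ y → fibre a y)) ⟩
  Σ< M (λ a → Σ< M (λ y → odd y * (4 * R a)))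
    ≡⟨ Σ<-cong M (λ a → Σ<-*ʳ M (4 * R a) odd) ⟩
  Σ< M (λ a → Σ< M odd * (4 * R a))
    ≡⟨ Σ<-cong M (λ a → cong (_* (4 * R a)) (Σ<-odd-indicator (suc n))) ⟩
  Σ< M (λ a → Q * (4 * R a))
    ≡⟨ Σ<-*ˡ M Q (λ a → 4 * R a) ⟩
  Q * Σ< M (λ a → 4 * R a)
    ≡⟨ cong (Q *_) (Σ<-*ˡ M 4 R) ⟩
  Q * (4 * Σ< M R)
    ≡⟨ cong (λ v → Q * (4 * v)) Σ<-R ⟩
  Q * (4 * (Q * (R 0 + R 1))) ∎
  where
  M = 2 ^ (2 + n)
  Q = 2 ^ suc n
  R : ℕ → ℕ
  R a = residueCount E n (a * a % 4)
  odd : ℕ → ℕ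
  odd y = 𝟙 (y % 2 ≡ᵇ 1)

  fibre : ∀ a y → Σ< M (λ z → 𝟙 ((y % 2 ≡ᵇ 1) ∧ E ((a * a + 4 * y * z) %2^ (2 + n)))) ≡ odd y * (4 * R a)
  fibre a y with y % 2 ≡ᵇ 1 in y-odd
  ... | false = Σ<-zero M
  ... | true  = trans (fibre-count n E a y (≡ᵇ⇒≡ (y % 2) 1 (subst T (sym y-odd) _))) (sym (+-identityʳ _))

  [2+a]²≡a²+[a+1]*4 : ∀ a → (2 + a) * (2 + a) ≡ a * a + (a + 1) * 4
  [2+a]²≡a²+[a+1]*4 = solve-∀

  [2+a]²%4≡a²%4 : ∀ a → (2 + a) * (2 + a) % 4 ≡ a * a % 4
  [2+a]²%4≡a²%4 a = trans (cong (_% 4) ([2+a]²≡a²+[a+1]*4 a)) ([m+kn]%n≡m%n (a * a) (a + 1) 4)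

  Σ<-R : Σ< M R ≡ Q * (R 0 + R 1)
  Σ<-R = begin
    Σ< (2 * Q) R           ≡⟨ cong (λ l → Σ< l R) (*-comm 2 Q) ⟩
    Σ< (Q * 2) R           ≡⟨ Σ<-periodic Q 2 R (λ a → cong (residueCount E n) ([2+a]²%4≡a²%4 a)) ⟩
    Q * (R 0 + (R 1 + 0))  ≡⟨ cong (λ v → Q * (R 0 + v)) (+-identityʳ (R 1)) ⟩
    Q * (R 0 + R 1)        ∎

/-cong-cross : ∀ m n o p .{{_ : NonZero n}} .{{_ : NonZero p}} →
               m * p ≡ o * n → ℤ.+ m ℚ./ n ≡ ℤ.+ o ℚ./ p
/-cong-cross m (suc n) o (suc p) mp≡on = ℚP.fromℚᵘ-cong {mkℚᵘ (ℤ.+ m) n} {mkℚᵘ (ℤ.+ o) p}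
  (*≡* (trans (sym (ℤP.pos-* m (suc p))) (trans (cong ℤ.+_ mp≡on) (ℤP.pos-* o (suc n)))))

dyadic : ℕ → ℕ → ℚ
dyadic m e = ℤ.+ m ℚ./ 2 ^ e
  where instance _ = m^n≢0 2 e

dyadic-zero : ∀ e → dyadic 0 e ≡ 0ℚ
dyadic-zero e = ℚP.0/n≡0 (2 ^ e) {{m^n≢0 2 e}}

dyadic-*2^ : ∀ t w e → dyadic (2 ^ t * w) (t + e) ≡ dyadic w e
dyadic-*2^ t w e = /-cong-cross (2 ^ t * w) (2 ^ (t + e)) w (2 ^ e) {{m^n≢0 2 (t + e)}} {{m^n≢0 2 e}} (begin
  2 ^ t * w * 2 ^ e    ≡⟨ regroup (2 ^ t) w (2 ^ e) ⟩
  w * (2 ^ t * 2 ^ e)  ≡⟨ cong (w *_) (^-distribˡ-+-* 2 t e) ⟨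
  w * 2 ^ (t + e)      ∎)
  where
  regroup : ∀ a b c → a * b * c ≡ b * (a * c)
  regroup = solve-∀

dyadic-2^ : ∀ m e {d} → m + e ≡ d → dyadic (2 ^ m) d ≡ 2^- e
dyadic-2^ m e refl = trans (cong (λ w → dyadic w (m + e)) (sym (*-identityʳ (2 ^ m)))) (dyadic-*2^ m 1 e)

Pr-cong : ∀ N {E E′} → (∀ b → E b ≡ E′ b) → Pr N E ≡ Pr N E′
Pr-cong N E≗E′ = cong (λ c → dyadic c (3 * N ∸ 1))
  (Σ<-cong M (λ a → Σ<-cong M (λ y → Σ<-cong M (λ z →
    cong (λ v → 𝟙 ((y % 2 ≡ᵇ 1) ∧ v)) (E≗E′ _)))))
  where M = 2 ^ N

Pr-residues : ∀ n E → Pr (2 + n) E ≡ dyadic (residueCount E n 0 + residueCount E n 1) (suc n)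
Pr-residues n E = /-cong-cross (count (2 + n) E) _ R Q {{m^n≢0 2 (3 * (2 + n) ∸ 1)}} {{m^n≢0 2 (suc n)}} (begin
  count (2 + n) E * Q        ≡⟨ cong (_* Q) (count-residues n E) ⟩
  Q * (4 * (Q * R)) * Q      ≡⟨ regroup Q R ⟩
  R * (Q * Q * 2 ^ 2 * Q)    ≡⟨ cong (R *_) 2^[3*[2+n]∸1] ⟨
  R * 2 ^ (3 * (2 + n) ∸ 1)  ∎)
  where
  Q = 2 ^ suc n
  R = residueCount E n 0 + residueCount E n 1

  regroup : ∀ Q R → Q * (4 * (Q * R)) * Q ≡ R * (Q * Q * 4 * Q)
  regroup = solve-∀

  3*[2+n]≡1+[1+n]+[1+n]+2+[1+n] : ∀ n → 3 * (2 + n) ≡ 1 + (suc n + suc n + 2 + suc n)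
  3*[2+n]≡1+[1+n]+[1+n]+2+[1+n] = solve-∀

  2^[3*[2+n]∸1] : 2 ^ (3 * (2 + n) ∸ 1) ≡ Q * Q * 2 ^ 2 * Q
  2^[3*[2+n]∸1] = begin
    2 ^ (3 * (2 + n) ∸ 1)            ≡⟨ cong (λ e → 2 ^ (e ∸ 1)) (3*[2+n]≡1+[1+n]+[1+n]+2+[1+n] n) ⟩
    2 ^ (suc n + suc n + 2 + suc n)  ≡⟨ ^-distribˡ-+-* 2 (suc n + suc n + 2) (suc n) ⟩
    2 ^ (suc n + suc n + 2) * Q      ≡⟨ cong (_* Q) (^-distribˡ-+-* 2 (suc n + suc n) 2) ⟩
    2 ^ (suc n + suc n) * 2 ^ 2 * Q  ≡⟨ cong (λ v → v * 2 ^ 2 * Q) (^-distribˡ-+-* 2 (suc n) (suc n)) ⟩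
    Q * Q * 2 ^ 2 * Q                ∎

unitEvent : ℕ → (ℕ → Bool) → Event
unitEvent k φ b = val≡ k b ∧ φ ((b /2^ k) % 8)

oddResidueCount : (ℕ → Bool) → ℕ
oddResidueCount φ = 𝟙 (φ 1) + 𝟙 (φ 3) + 𝟙 (φ 5) + 𝟙 (φ 7)

weight : ℕ → (ℕ → Bool) → ℕ
weight 0             φ = 𝟙 (φ 1) + 𝟙 (φ 5)
weight 1             φ = 0
weight (suc (suc _)) φ = oddResidueCount φ

n%2≡1⇒[n≡ᵇ0]≡false : ∀ n → n % 2 ≡ 1 → (n ≡ᵇ 0) ≡ false
n%2≡1⇒[n≡ᵇ0]≡false (suc n) _ = refl

not[n%2≡ᵇ0]≡n%2≡ᵇ1 : ∀ n → not (n % 2 ≡ᵇ 0) ≡ (n % 2 ≡ᵇ 1)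
not[n%2≡ᵇ0]≡n%2≡ᵇ1 n with n%2-cases n
... | inj₁ (n-even , _) rewrite n-even = refl
... | inj₂ (n-odd , _)  rewrite n-odd  = refl

unitEvent-zero : ∀ φ x → unitEvent 0 φ x ≡ (x % 2 ≡ᵇ 1) ∧ φ (x % 8)
unitEvent-zero φ x = begin
  ((x % 1 ≡ᵇ 0) ∧ not (x % 2 ≡ᵇ 0)) ∧ φ (x / 1 % 8)  ≡⟨ cong₂ (λ r q → ((r ≡ᵇ 0) ∧ not (x % 2 ≡ᵇ 0)) ∧ φ (q % 8))
                                                              (n%1≡0 x) (n/1≡n x) ⟩
  not (x % 2 ≡ᵇ 0) ∧ φ (x % 8)                       ≡⟨ cong (_∧ φ (x % 8)) (not[n%2≡ᵇ0]≡n%2≡ᵇ1 x) ⟩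
  (x % 2 ≡ᵇ 1) ∧ φ (x % 8)                           ∎

unitEvent-zero-even : ∀ φ x → unitEvent 0 φ (x * 2) ≡ false
unitEvent-zero-even φ x =
  trans (unitEvent-zero φ (x * 2)) (cong (λ r → (r ≡ᵇ 1) ∧ φ (x * 2 % 8)) (m*n%n≡0 x 2))

unitEvent-odd : ∀ j φ x → unitEvent (suc j) φ (1 + x * 2) ≡ false
unitEvent-odd j φ x =
  cong (λ a → (a ∧ not (y %2^ suc (suc j) ≡ᵇ 0)) ∧ φ (y /2^ suc j % 8))
       (n%2≡1⇒[n≡ᵇ0]≡false (y %2^ suc j) odd)
  where
  y = 1 + x * 2
  odd : y %2^ suc j % 2 ≡ 1
  odd = trans (m∣n⇒o%n%m≡o%m 2 (2 ^ suc j) y {{_}} {{m^n≢0 2 (suc j)}} (divides (2 ^ j) (*-comm 2 (2 ^ j))))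
              ([m+kn]%n≡m%n 1 x 2)

unitEvent-double : ∀ j φ x → unitEvent (suc j) φ (x * 2) ≡ unitEvent j φ x
unitEvent-double j φ x = cong₂ (λ a b → a ∧ φ (b % 8)) val≡-double /2^-double
  where
  instance
    _ = m^n≢0 2 j
    2^j*2≢0 = m*n≢0 (2 ^ j) 2

  %2^-double : ∀ j → (x * 2) %2^ suc j ≡ x %2^ j * 2
  %2^-double j = trans (%-congʳ {{m^n≢0 2 (suc j)}} {{m*n≢0 (2 ^ j) 2 {{m^n≢0 2 j}}}} (*-comm 2 (2 ^ j)))
                       (sym (m%n*o≡m*o%[n*o] x (2 ^ j) 2 {{m^n≢0 2 j}} {{m*n≢0 (2 ^ j) 2 {{m^n≢0 2 j}}}}))

  *2≡ᵇ0 : ∀ n → (n * 2 ≡ᵇ 0) ≡ (n ≡ᵇ 0)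
  *2≡ᵇ0 zero    = refl
  *2≡ᵇ0 (suc n) = refl

  val≡-double : val≡ (suc j) (x * 2) ≡ val≡ j x
  val≡-double = cong₂ (λ a b → a ∧ not b)
    (trans (cong (_≡ᵇ 0) (%2^-double j)) (*2≡ᵇ0 (x %2^ j)))
    (trans (cong (_≡ᵇ 0) (%2^-double (suc j))) (*2≡ᵇ0 (x %2^ suc j)))

  /2^-double : (x * 2) /2^ suc j ≡ x /2^ j
  /2^-double = trans (/-congʳ {{m^n≢0 2 (suc j)}} (*-comm 2 (2 ^ j))) (m*n/o*n≡m/o x 2 (2 ^ j))

x*4≡x*2*2 : ∀ x → x * 4 ≡ x * 2 * 2
x*4≡x*2*2 x = sym (*-assoc x 2 2)

unitEvent-1mod4 : ∀ j φ x → unitEvent (suc j) φ (1 + x * 4) ≡ false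
unitEvent-1mod4 j φ x = trans (cong (λ y → unitEvent (suc j) φ (1 + y)) (x*4≡x*2*2 x)) (unitEvent-odd j φ (x * 2))

unitEvent-quadruple : ∀ j φ x → unitEvent (2 + j) φ (x * 4) ≡ unitEvent j φ x
unitEvent-quadruple j φ x = begin
  unitEvent (2 + j) φ (x * 4)      ≡⟨ cong (unitEvent (2 + j) φ) (x*4≡x*2*2 x) ⟩
  unitEvent (2 + j) φ (x * 2 * 2)  ≡⟨ unitEvent-double (suc j) φ (x * 2) ⟩
  unitEvent (1 + j) φ (x * 2)      ≡⟨ unitEvent-double j φ x ⟩
  unitEvent j φ x                  ∎

Σ<-unitEvent : ∀ j t φ → Σ< (2 ^ (j + 3 + t)) (λ x → 𝟙 (unitEvent j φ x)) ≡ 2 ^ t * oddResidueCount φ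
Σ<-unitEvent zero t φ = begin
  Σ< (2 ^ (3 + t)) (λ x → 𝟙 (unitEvent 0 φ x))  ≡⟨ Σ<-cong (2 ^ (3 + t)) (λ x → cong 𝟙 (unitEvent-zero φ x)) ⟩
  Σ< (2 ^ (3 + t)) h                            ≡⟨ cong (λ l → Σ< l h) (2*[2*[2*P]]≡P*8 (2 ^ t)) ⟩
  Σ< (2 ^ t * 8) h                              ≡⟨ Σ<-periodic (2 ^ t) 8 h periodic ⟩
  2 ^ t * Σ< 8 h                                ≡⟨ cong (2 ^ t *_)
                                                        (reassoc (𝟙 (φ 1)) (𝟙 (φ 3)) (𝟙 (φ 5)) (𝟙 (φ 7))) ⟩
  2 ^ t * oddResidueCount φ                     ∎
  where
  h : ℕ → ℕ
  h x = 𝟙 ((x % 2 ≡ᵇ 1) ∧ φ (x % 8))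

  2*[2*[2*P]]≡P*8 : ∀ P → 2 * (2 * (2 * P)) ≡ P * 8
  2*[2*[2*P]]≡P*8 = solve-∀

  periodic : ∀ i → h (8 + i) ≡ h i
  periodic i = cong₂ (λ a b → 𝟙 ((a ≡ᵇ 1) ∧ φ b)) (%-remove-+ˡ i (divides 4 refl)) (%-remove-+ˡ i ∣-refl)

  reassoc : ∀ a b c d → a + (b + (c + (d + 0))) ≡ a + b + c + d
  reassoc = solve-∀
Σ<-unitEvent (suc j) t φ = begin
  Σ< (2 * M) (λ x → 𝟙 (unitEvent (suc j) φ x))  ≡⟨ cong (λ l → Σ< l (λ x → 𝟙 (unitEvent (suc j) φ x)))
                                                        (*-comm 2 M) ⟩
  Σ< (M * 2) (λ x → 𝟙 (unitEvent (suc j) φ x))  ≡⟨ Σ<-* M 2 _ ⟩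
  Σ< M (λ q → 𝟙 (unitEvent (suc j) φ (q * 2 + 0)) + (𝟙 (unitEvent (suc j) φ (q * 2 + 1)) + 0))
                                                ≡⟨ Σ<-cong M halve ⟩
  Σ< M (λ q → 𝟙 (unitEvent j φ q))              ≡⟨ Σ<-unitEvent j t φ ⟩
  2 ^ t * oddResidueCount φ                     ∎
  where
  M = 2 ^ (j + 3 + t)
  halve : ∀ q → 𝟙 (unitEvent (suc j) φ (q * 2 + 0)) + (𝟙 (unitEvent (suc j) φ (q * 2 + 1)) + 0)
                  ≡ 𝟙 (unitEvent j φ q)
  halve q = trans (cong₂ (λ a b → 𝟙 a + (𝟙 b + 0))
                         (trans (cong (unitEvent (suc j) φ) (+-identityʳ (q * 2))) (unitEvent-double j φ q))
                         (trans (cong (unitEvent (suc j) φ) (+-comm (q * 2) 1)) (unitEvent-odd j φ q)))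
                  (+-identityʳ _)

residueCount-∅ : ∀ E n r → (∀ x → E (r + x * 4) ≡ false) → residueCount E n r ≡ 0
residueCount-∅ E n r ∅ = trans (Σ<-cong (2 ^ n) (λ x → cong 𝟙 (∅ x))) (Σ<-zero (2 ^ n))

residueCount-1-unitEvent-zero : ∀ t φ → residueCount (unitEvent 0 φ) (suc t) 1 ≡ 2 ^ t * (𝟙 (φ 1) + 𝟙 (φ 5))
residueCount-1-unitEvent-zero t φ = begin
  Σ< (2 ^ suc t) (λ x → 𝟙 (unitEvent 0 φ (1 + x * 4)))  ≡⟨ Σ<-cong (2 ^ suc t) (λ x → cong 𝟙 (unitEvent-1+4x x)) ⟩
  Σ< (2 * 2 ^ t) g                                     ≡⟨ cong (λ l → Σ< l g) (*-comm 2 (2 ^ t)) ⟩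
  Σ< (2 ^ t * 2) g                                     ≡⟨ Σ<-periodic (2 ^ t) 2 g periodic ⟩
  2 ^ t * (𝟙 (φ 1) + (𝟙 (φ 5) + 0))                    ≡⟨ cong (λ v → 2 ^ t * (𝟙 (φ 1) + v)) (+-identityʳ (𝟙 (φ 5))) ⟩
  2 ^ t * (𝟙 (φ 1) + 𝟙 (φ 5))                          ∎
  where
  g : ℕ → ℕ
  g x = 𝟙 (φ ((1 + x * 4) % 8))

  [1+x*4]%2≡1 : ∀ x → (1 + x * 4) % 2 ≡ 1
  [1+x*4]%2≡1 x = trans (cong (λ y → (1 + y) % 2) (x*4≡x*2*2 x)) ([m+kn]%n≡m%n 1 (x * 2) 2)

  unitEvent-1+4x : ∀ x → unitEvent 0 φ (1 + x * 4) ≡ φ ((1 + x * 4) % 8)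
  unitEvent-1+4x x = trans (unitEvent-zero φ (1 + x * 4))
                           (cong (λ r → (r ≡ᵇ 1) ∧ φ ((1 + x * 4) % 8)) ([1+x*4]%2≡1 x))

  1+[2+i]*4≡8+[1+i*4] : ∀ i → 1 + (2 + i) * 4 ≡ 8 + (1 + i * 4)
  1+[2+i]*4≡8+[1+i*4] = solve-∀

  periodic : ∀ i → g (2 + i) ≡ g i
  periodic i = cong (λ r → 𝟙 (φ r))
                    (trans (cong (_% 8) (1+[2+i]*4≡8+[1+i*4] i)) (%-remove-+ˡ {8} (1 + i * 4) ∣-refl))

residues-unitEvent : ∀ k t φ →
  residueCount (unitEvent k φ) (k + 1 + t) 0 + residueCount (unitEvent k φ) (k + 1 + t) 1 ≡ 2 ^ t * weight k φ
residues-unitEvent 0 t φ =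
  trans (cong (_+ residueCount (unitEvent 0 φ) (suc t) 1) (residueCount-∅ (unitEvent 0 φ) (suc t) 0 4x-∅))
        (residueCount-1-unitEvent-zero t φ)
  where
  4x-∅ : ∀ x → unitEvent 0 φ (x * 4) ≡ false
  4x-∅ x = trans (cong (unitEvent 0 φ) (x*4≡x*2*2 x)) (unitEvent-zero-even φ (x * 2))
residues-unitEvent 1 t φ = begin
  residueCount (unitEvent 1 φ) (2 + t) 0 + residueCount (unitEvent 1 φ) (2 + t) 1
    ≡⟨ cong₂ _+_ (residueCount-∅ (unitEvent 1 φ) (2 + t) 0 4x-∅)
                 (residueCount-∅ (unitEvent 1 φ) (2 + t) 1 (unitEvent-1mod4 0 φ)) ⟩
  0 ≡⟨ *-zeroʳ (2 ^ t) ⟨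
  2 ^ t * 0 ∎
  where
  4x-∅ : ∀ x → unitEvent 1 φ (x * 4) ≡ false
  4x-∅ x = trans (cong (unitEvent 1 φ) (x*4≡x*2*2 x)) (trans (unitEvent-double 0 φ (x * 2)) (unitEvent-zero-even φ x))
residues-unitEvent (suc (suc j)) t φ = begin
  residueCount (unitEvent (2 + j) φ) n 0 + residueCount (unitEvent (2 + j) φ) n 1
    ≡⟨ cong (residueCount (unitEvent (2 + j) φ) n 0 +_)
            (residueCount-∅ (unitEvent (2 + j) φ) n 1 (unitEvent-1mod4 (suc j) φ)) ⟩
  residueCount (unitEvent (2 + j) φ) n 0 + 0
    ≡⟨ +-identityʳ _ ⟩
  Σ< (2 ^ n) (λ x → 𝟙 (unitEvent (2 + j) φ (x * 4)))
    ≡⟨ Σ<-cong (2 ^ n) (λ x → cong 𝟙 (unitEvent-quadruple j φ x)) ⟩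
  Σ< (2 ^ n) (λ x → 𝟙 (unitEvent j φ x))
    ≡⟨ cong (λ e → Σ< (2 ^ e) (λ x → 𝟙 (unitEvent j φ x))) (n≡j+3+t j t) ⟩
  Σ< (2 ^ (j + 3 + t)) (λ x → 𝟙 (unitEvent j φ x))
    ≡⟨ Σ<-unitEvent j t φ ⟩
  2 ^ t * oddResidueCount φ ∎
  where
  n = 2 + j + 1 + t
  n≡j+3+t : ∀ j t → 2 + j + 1 + t ≡ j + 3 + t
  n≡j+3+t = solve-∀

Pr-unitEvent : ∀ {k N} → k + 3 ≤ N → ∀ φ → Pr N (unitEvent k φ) ≡ dyadic (weight k φ) (k + 2)
Pr-unitEvent {k} k+3≤N φ with m≤n⇒∃[o]m+o≡n k+3≤N
... | t , refl = begin
  Pr (k + 3 + t) (unitEvent k φ)             ≡⟨ cong (λ N → Pr N (unitEvent k φ)) (k+3+t≡2+n k t) ⟩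
  Pr (2 + n) (unitEvent k φ)                 ≡⟨ Pr-residues n (unitEvent k φ) ⟩
  dyadic (residueCount (unitEvent k φ) n 0 + residueCount (unitEvent k φ) n 1) (suc n)
                                             ≡⟨ cong₂ dyadic (residues-unitEvent k t φ) (1+n≡t+[k+2] k t) ⟩
  dyadic (2 ^ t * weight k φ) (t + (k + 2))  ≡⟨ dyadic-*2^ t (weight k φ) (k + 2) ⟩
  dyadic (weight k φ) (k + 2)                ∎
  where
  n = k + 1 + t
  k+3+t≡2+n : ∀ k t → k + 3 + t ≡ 2 + (k + 1 + t)
  k+3+t≡2+n = solve-∀
  1+n≡t+[k+2] : ∀ k t → suc (k + 1 + t) ≡ t + (k + 2)
  1+n≡t+[k+2] = solve-∀

-- ev-sqf≡mod8 k i and ev-sqf≡2mod4 k are definitionally unitEvent k (sqf≡mod8 k i) and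
-- unitEvent k (sqf≡2mod4 k); only ev-sqf≡3mod4, which reads u mod 4, needs a proof.
sqf≡mod8 : ℕ → ℕ → ℕ → Bool
sqf≡mod8 k i u = evenᵇ k ∧ (u ≡ᵇ i)

sqf≡3mod4 : ℕ → ℕ → Bool
sqf≡3mod4 k u = evenᵇ k ∧ (u % 4 ≡ᵇ 3)

sqf≡2mod4 : ℕ → ℕ → Bool
sqf≡2mod4 k _ = not (evenᵇ k)

ev-sqf≡3mod4≗unitEvent : ∀ k b → ev-sqf≡3mod4 k b ≡ unitEvent k (sqf≡3mod4 k) b
ev-sqf≡3mod4≗unitEvent k b =
  cong (λ r → val≡ k b ∧ evenᵇ k ∧ (r ≡ᵇ 3)) (sym (m∣n⇒o%n%m≡o%m 4 8 (b /2^ k) (divides 2 refl)))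

evenᵇ-true : ∀ {k} → 2 ∣ k → evenᵇ k ≡ true
evenᵇ-true {k} 2∣k = cong (_≡ᵇ 0) (n∣m⇒m%n≡0 k 2 2∣k)

evenᵇ-false : ∀ {k} → ¬ 2 ∣ k → evenᵇ k ≡ false
evenᵇ-false {k} 2∤k with n%2-cases k
... | inj₁ (k-even , _) = contradiction (m%n≡0⇒n∣m k 2 k-even) 2∤k
... | inj₂ (k-odd , _)  = cong (_≡ᵇ 0) k-odd

weight-∅ : ∀ k → weight k (λ _ → false) ≡ 0
weight-∅ zero          = refl
weight-∅ (suc zero)    = refl
weight-∅ (suc (suc _)) = refl

weight-≡1≡weight-≡5 : ∀ k e → weight k (λ u → e ∧ (u ≡ᵇ 1)) ≡ weight k (λ u → e ∧ (u ≡ᵇ 5))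
weight-≡1≡weight-≡5 k             false = refl
weight-≡1≡weight-≡5 zero          true  = refl
weight-≡1≡weight-≡5 (suc zero)    true  = refl
weight-≡1≡weight-≡5 (suc (suc _)) true  = refl

weight-odd : ∀ {k} → ¬ 2 ∣ k → ∀ (ψ : ℕ → Bool) → weight k (λ u → evenᵇ k ∧ ψ u) ≡ 0
weight-odd {k} 2∤k ψ = trans (cong (λ e → weight k (λ u → e ∧ ψ u)) (evenᵇ-false 2∤k)) (weight-∅ k)

weight-sqf≡1mod8-even : ∀ {k} → 2 ∣ k → weight k (sqf≡mod8 k 1) ≡ 1
weight-sqf≡1mod8-even {zero}        _   = refl
weight-sqf≡1mod8-even {suc zero}    2∣1 = contradiction (∣1⇒≡1 2∣1) λ ()
weight-sqf≡1mod8-even {suc (suc j)} 2∣k =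
  cong (λ e → weight (2 + j) (λ u → e ∧ (u ≡ᵇ 1))) (evenᵇ-true 2∣k)

weight-sqf≡3mod4-∅ : ∀ {k} → ¬ 2 ∣ k ⊎ k ≡ 0 → weight k (sqf≡3mod4 k) ≡ 0
weight-sqf≡3mod4-∅ (inj₁ 2∤k)  = weight-odd 2∤k (λ u → u % 4 ≡ᵇ 3)
weight-sqf≡3mod4-∅ (inj₂ refl) = refl

weight-sqf≡3mod4-even : ∀ {k} → 2 ∣ k → 2 ≤ k → weight k (sqf≡3mod4 k) ≡ 2
weight-sqf≡3mod4-even {suc zero}    _   (s≤s ())
weight-sqf≡3mod4-even {suc (suc j)} 2∣k _ =
  cong (λ e → weight (2 + j) (λ u → e ∧ (u % 4 ≡ᵇ 3))) (evenᵇ-true 2∣k)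

weight-sqf≡2mod4-∅ : ∀ {k} → 2 ∣ k ⊎ k ≡ 1 → weight k (sqf≡2mod4 k) ≡ 0
weight-sqf≡2mod4-∅ {k} (inj₁ 2∣k) = trans (cong (λ e → weight k (λ _ → not e)) (evenᵇ-true 2∣k)) (weight-∅ k)
weight-sqf≡2mod4-∅ (inj₂ refl)    = refl

weight-sqf≡2mod4-odd : ∀ {k} → ¬ 2 ∣ k → 3 ≤ k → weight k (sqf≡2mod4 k) ≡ 4
weight-sqf≡2mod4-odd {suc zero}    _   (s≤s ())
weight-sqf≡2mod4-odd {suc (suc j)} 2∤k _ = cong (λ e → weight (2 + j) (λ _ → not e)) (evenᵇ-false 2∤k)

theorem6p3 : (k N : ℕ) → k + 3 ≤ N →
    -- (1)
    (Pr N (ev-sqf≡mod8 k 1) ≡ Pr N (ev-sqf≡mod8 k 5)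
      × (¬ (2 ∣ k) → Pr N (ev-sqf≡mod8 k 1) ≡ 0ℚ)
      × (2 ∣ k → Pr N (ev-sqf≡mod8 k 1) ≡ 2^- (k + 2)))
    -- (2)
    × (((¬ (2 ∣ k)) ⊎ k ≡ 0 → Pr N (ev-sqf≡3mod4 k) ≡ 0ℚ)
      × (2 ∣ k → 2 ≤ k → Pr N (ev-sqf≡3mod4 k) ≡ 2^- (k + 1)))
    -- (3)
    × ((2 ∣ k ⊎ k ≡ 1 → Pr N (ev-sqf≡2mod4 k) ≡ 0ℚ)
      × (¬ (2 ∣ k) → 3 ≤ k → Pr N (ev-sqf≡2mod4 k) ≡ 2^- k))
theorem6p3 k N k+3≤N =
    ( trans (Pr≡ (sqf≡mod8 k 1) (weight-≡1≡weight-≡5 k (evenᵇ k))) (sym (Pr≡ (sqf≡mod8 k 5) refl))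
    , (λ 2∤k → trans (Pr≡ (sqf≡mod8 k 1) (weight-odd 2∤k (_≡ᵇ 1))) (dyadic-zero (k + 2)))
    , (λ 2∣k → Pr≡ (sqf≡mod8 k 1) (weight-sqf≡1mod8-even 2∣k)) )
  , ( (λ h → trans Pr-sqf≡3mod4 (trans (Pr≡ (sqf≡3mod4 k) (weight-sqf≡3mod4-∅ h)) (dyadic-zero (k + 2))))
    , (λ 2∣k 2≤k → trans Pr-sqf≡3mod4 (trans (Pr≡ (sqf≡3mod4 k) (weight-sqf≡3mod4-even 2∣k 2≤k))
                                              (dyadic-2^ 1 (k + 1) (sym (+-suc k 1))))) )
  , ( (λ h → trans (Pr≡ (sqf≡2mod4 k) (weight-sqf≡2mod4-∅ h)) (dyadic-zero (k + 2)))
    , (λ 2∤k 3≤k → trans (Pr≡ (sqf≡2mod4 k) (weight-sqf≡2mod4-odd 2∤k 3≤k)) (dyadic-2^ 2 k (+-comm 2 k))) )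
  where
  Pr≡ : ∀ φ {w} → weight k φ ≡ w → Pr N (unitEvent k φ) ≡ dyadic w (k + 2)
  Pr≡ φ refl = Pr-unitEvent k+3≤N φ

  Pr-sqf≡3mod4 : Pr N (ev-sqf≡3mod4 k) ≡ Pr N (unitEvent k (sqf≡3mod4 k))
  Pr-sqf≡3mod4 = Pr-cong N (ev-sqf≡3mod4≗unitEvent k)
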